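{- Let $n\ge1$. If $c\lessdot d$ is a cover relation in $\mathcal{D}(n)$, then $\mathsf{s}(c)\lessdot\mathsf{s}(d)$ is a cover relation in $\mathbb{N}^r$ (componentwise order).
   Context: $\beta(n)=b_1\cdots b_k$ is the binary expansion ($b_1=1$ most significant); its principal prefix is $b_1\cdots b_r$, where $b_{r+1}$ is the rightmost $0$ of $\beta(n)$ ($r=0$ if none). A hyperbinary expansion of $n$ is a word $d_1\cdots d_k$ over $\{0,1,2\}$ with $\sum_i d_i2^{k-i}=n$, corresponding to the hyperbinary partition (parts powers of $2$, each at most twice) in which $2^{k-i}$ has multiplicity $d_i$; $\mathcal{D}(n)$ is the set of these ordered by transporting refinement of partitions ($\mu\le\lambda$ if the parts of $\lambda$ can be subdivided to produce the parts of $\mu$). $s_j(c)=\sum_{i=1}^jc_i2^{j-i}$ and $\mathsf{s}(c)=(s_1(c),\dots,s_r(c))$. -}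

module Defs where

open import Data.Nat using (ℕ; zero; suc; _+_; _*_; _^_; _≤_; _/_; _%_; _≡ᵇ_)
open import Data.Bool using (Bool; true; false; if_then_else_)
open import Data.Fin using (Fin; toℕ)
open import Data.List using (List; []; _∷_; length; replicate; _++_; concat; take; reverse)
open import Data.Nat.ListAction using (sum)
open import Data.List.Relation.Binary.Pointwise using (Pointwise)
open import Data.List.Relation.Binary.Permutation.Propositional using (_↭_)
open import Data.Maybe using (Maybe; just; nothing; maybe)
open import Data.Vec using (Vec; tabulate)
import Data.Vec.Relation.Binary.Pointwise.Inductive as VP
open import Data.Product using (Σ; _×_; ∃)
open import Data.Sum using (_⊎_)
open import Data.Unit using (⊤)
open import Relation.Binary.PropositionalEquality using (_≡_; _≢_)
open import Function using (id)

-- Binary digits, least significant first (fuel-bounded; fuel m ≥ number of digits).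
bitsLSB : ℕ → ℕ → List Bool
bitsLSB zero    m = []
bitsLSB (suc f) m = if m ≡ᵇ 0 then [] else ((m % 2) ≡ᵇ 1) ∷ bitsLSB f (m / 2)

-- β(n) = b₁ ⋯ b_k, most significant bit first (true = 1, false = 0).
β : ℕ → List Bool
β n = reverse (bitsLSB n n)

len : ℕ → ℕ
len n = length (β n)

-- 0-based index of the rightmost 0 in a bit word (nothing if there is no 0).
rightmostZero : List Bool → Maybe ℕ
rightmostZero [] = nothing
rightmostZero (b ∷ bs) with rightmostZero bs
... | just i  = just (suc i)
... | nothing = if b then nothing else just 0

-- r = length of the principal prefix b₁⋯b_r, where b_{r+1} is the rightmost 0 (r = 0 if none).
ppLen : ℕ → ℕ
ppLen n = maybe id 0 (rightmostZero (β n))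

-- Words over {0,1,2}, most significant digit first.
Word : Set
Word = List (Fin 3)

value : Word → ℕ
value []       = 0
value (d ∷ ds) = toℕ d * 2 ^ length ds + value ds

IsHB : ℕ → Word → Set
IsHB n c = (length c ≡ len n) × (value c ≡ n)

parts : Word → List ℕ
parts []       = []
parts (d ∷ ds) = replicate (toℕ d) (2 ^ length ds) ++ parts ds

Refines : List ℕ → List ℕ → Set
Refines μ λ′ = ∃ λ (blocks : List (List ℕ)) →
  Pointwise (λ b p → sum b ≡ p) blocks λ′ × (concat blocks ↭ μ)

_≤D_ : Word → Word → Set
c ≤D d = Refines (parts c) (parts d)

Covers : {A : Set} → (A → Set) → (A → A → Set) → A → A → Set
Covers {A} P _≼_ x y =
  (x ≼ y) × (x ≢ y) × ((z : A) → P z → x ≼ z → z ≼ y → (z ≡ x) ⊎ (z ≡ y))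

CoversD : ℕ → Word → Word → Set
CoversD n = Covers (IsHB n) _≤D_

sⱼ : ℕ → Word → ℕ
sⱼ j c = value (take j c)

𝗌 : (r : ℕ) → Word → Vec ℕ r
𝗌 r c = tabulate (λ (j : Fin r) → sⱼ (suc (toℕ j)) c)

_≤ᵥ_ : {r : ℕ} → Vec ℕ r → Vec ℕ r → Set
_≤ᵥ_ = VP.Pointwise _≤_

CoversNʳ : (r : ℕ) → Vec ℕ r → Vec ℕ r → Set
CoversNʳ r = Covers (λ _ → ⊤) (_≤ᵥ_ {r})

{-# OPTIONS --safe #-}
module Submission where

-- Let k = len n and write u i = sⱼ i c, v i = sⱼ i d.  The prefix values of a word of length k
-- are exactly the sequences with u 0 = 0 and 2 u i ≤ u (1 + i) ≤ 2 u i + 2, and they determine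
-- the word.  Refinement is read off the prefix values: Σ ⌊part / 2^(k ∸ i)⌋ over the parts of c
-- equals u i and can only decrease under refinement, while conversely u ≤ v lets the parts of d
-- be split top-down, carrying the surplus to the next smaller power.  So on 𝒟(n), c ≤ d iff
-- u ≤ v pointwise.  For two expansions of n moreover v i ≤ u i + 1, and u i does not depend on
-- the expansion for i > r = ppLen n, since there 2^(k ∸ i) divides n + 1.  If c ⋖ d and u, v
-- differed at two indices, splicing them would produce an expansion strictly between c and d.
-- Hence 𝗌(c) and 𝗌(d) differ by one unit vector, which is a cover in ℕʳ.

open import Defs
open import Algebra.Properties.CommutativeSemigroup using (x∙yz≈y∙xz)
open import Data.Bool using (Bool; true; false; T)
open import Data.Empty using (⊥; ⊥-elim)
open import Data.Fin using (Fin; toℕ; fromℕ<)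
import Data.Fin.Properties as Fin
open import Data.List using (List; []; _∷_; length; replicate; _++_; take; drop; [_]; map; concat; reverse)
open import Data.List.Properties
  using (length-++; length-reverse; unfold-reverse; length-take; length-drop; take++drop≡id; take-all;
         map-++; concat-++; ++-assoc; concat-map-[_])
open import Data.List.Relation.Binary.Pointwise as Pointwise using (Pointwise; []; _∷_)
open import Data.List.Relation.Binary.Permutation.Propositional using (_↭_; ↭-refl)
import Data.List.Relation.Binary.Permutation.Propositional.Properties as ↭
open import Data.Maybe using (just; maybe)
open import Data.Nat
  using (ℕ; zero; suc; _+_; _*_; _∸_; _^_; _≤_; _<_; z≤n; s≤s; s≤s⁻¹; z<s; NonZero; _/_; _%_; _≡ᵇ_;
         _≟_; _<?_; _≤?_)
open import Data.Nat.Divisibility using (_∣_; divides; 1∣_; *-monoʳ-∣)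
open import Data.Nat.DivMod using (m≡m%n+[m/n]*n; m*n/n≡m; m/n*n≤m; /-monoˡ-≤; m<n⇒m/n≡0; 0/n≡0)
open import Data.Nat.ListAction using (sum)
open import Data.Nat.ListAction.Properties using (sum-++; sum-↭)
open import Data.Nat.Properties
open import Data.Nat.Tactic.RingSolver using (solve-∀)
open import Data.Product using (_×_; _,_; proj₁; proj₂; ∃-syntax)
open import Data.Sum using (_⊎_; inj₁; inj₂; [_,_]′)
open import Data.Unit using (⊤; tt)
open import Data.Vec using (Vec; tabulate; lookup)
open import Data.Vec.Properties using (≡-dec; tabulate∘lookup; tabulate-cong; lookup∘tabulate)
import Data.Vec.Relation.Binary.Pointwise.Inductive as Pointwiseᵥ
open import Function using (id; _∘_)
open import Relation.Binary.Definitions using (tri<; tri≈; tri>)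
open import Relation.Binary.PropositionalEquality hiding ([_])
open import Relation.Nullary using (¬_; Dec; yes; no; contradiction)

-- Prefix values of words

digit≤2 : (x : Fin 3) → toℕ x ≤ 2
digit≤2 = Fin.toℕ≤pred[n]

value-++ : ∀ xs ys → value (xs ++ ys) ≡ value xs * 2 ^ length ys + value ys
value-++ []       ys = refl
value-++ (x ∷ xs) ys = begin
  toℕ x * 2 ^ length (xs ++ ys) + value (xs ++ ys)
    ≡⟨ cong₂ (λ l v → toℕ x * 2 ^ l + v) (length-++ xs) (value-++ xs ys) ⟩
  toℕ x * 2 ^ (length xs + length ys) + (value xs * 2 ^ length ys + value ys)
    ≡⟨ cong (λ p → toℕ x * p + (value xs * 2 ^ length ys + value ys)) (^-distribˡ-+-* 2 (length xs) (length ys)) ⟩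
  toℕ x * (2 ^ length xs * 2 ^ length ys) + (value xs * 2 ^ length ys + value ys)
    ≡⟨ horner (toℕ x) (2 ^ length xs) (2 ^ length ys) (value xs) (value ys) ⟩
  (toℕ x * 2 ^ length xs + value xs) * 2 ^ length ys + value ys ∎
  where
  open ≡-Reasoning
  horner : ∀ a p q v w → a * (p * q) + (v * q + w) ≡ (a * p + v) * q + w
  horner = solve-∀

value+2≤2^suc-length : ∀ w → value w + 2 ≤ 2 ^ suc (length w)
value+2≤2^suc-length []       = ≤-refl
value+2≤2^suc-length (x ∷ w) = begin
  toℕ x * 2 ^ length w + value w + 2   ≡⟨ +-assoc (toℕ x * 2 ^ length w) (value w) 2 ⟩
  toℕ x * 2 ^ length w + (value w + 2) ≤⟨ +-mono-≤ (*-monoˡ-≤ (2 ^ length w) (digit≤2 x)) (value+2≤2^suc-length w) ⟩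
  2 * 2 ^ length w + 2 * 2 ^ length w  ≡⟨ double (2 ^ length w) ⟩
  2 * (2 * 2 ^ length w)               ∎
  where
  open ≤-Reasoning
  double : ∀ a → 2 * a + 2 * a ≡ 2 * (2 * a)
  double = solve-∀

length-take-≤ : ∀ {A : Set} i (xs : List A) → i ≤ length xs → length (take i xs) ≡ i
length-take-≤ i xs i≤ = trans (length-take i xs) (m≤n⇒m⊓n≡m i≤)

sⱼ-1 : ∀ x w → sⱼ 1 (x ∷ w) ≡ toℕ x
sⱼ-1 x w = trans (+-identityʳ _) (*-identityʳ (toℕ x))

sⱼ-∷ : ∀ i x w → i ≤ length w → sⱼ (suc i) (x ∷ w) ≡ toℕ x * 2 ^ i + sⱼ i w
sⱼ-∷ i x w i≤ = cong (λ l → toℕ x * 2 ^ l + sⱼ i w) (length-take-≤ i w i≤)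

sⱼ-≥length : ∀ i w → length w ≤ i → sⱼ i w ≡ value w
sⱼ-≥length i w w≤ = cong value (take-all i w w≤)

take-++-≤ : ∀ {A : Set} i (xs ys : List A) → i ≤ length xs → take i (xs ++ ys) ≡ take i xs
take-++-≤ zero    xs       ys _         = refl
take-++-≤ (suc i) (x ∷ xs) ys (s≤s i≤) = cong (x ∷_) (take-++-≤ i xs ys i≤)

value-split : ∀ i w → value w ≡ sⱼ i w * 2 ^ (length w ∸ i) + value (drop i w)
value-split i w = begin
  value w                                                 ≡⟨ cong value (take++drop≡id i w) ⟨
  value (take i w ++ drop i w)                            ≡⟨ value-++ (take i w) (drop i w) ⟩
  sⱼ i w * 2 ^ length (drop i w) + value (drop i w)
    ≡⟨ cong (λ l → sⱼ i w * 2 ^ l + value (drop i w)) (length-drop i w) ⟩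
  sⱼ i w * 2 ^ (length w ∸ i) + value (drop i w)          ∎
  where open ≡-Reasoning

sⱼ-brackets : ∀ {K n} i w → length w ≡ K → value w ≡ n →
  sⱼ i w * 2 ^ (K ∸ i) ≤ n × n + 2 ≤ (sⱼ i w + 2) * 2 ^ (K ∸ i)
sⱼ-brackets i w refl refl =
  subst (X * M ≤_) (sym value≡) (m≤m+n (X * M) R) ,
  (begin
    value w + 2     ≡⟨ cong (_+ 2) value≡ ⟩
    X * M + R + 2   ≡⟨ +-assoc (X * M) R 2 ⟩
    X * M + (R + 2) ≤⟨ +-monoʳ-≤ (X * M) R+2≤2M ⟩
    X * M + 2 * M   ≡⟨ *-distribʳ-+ M X 2 ⟨
    (X + 2) * M     ∎)
  where
  open ≤-Reasoning
  X = sⱼ i w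
  M = 2 ^ (length w ∸ i)
  R = value (drop i w)
  value≡ : value w ≡ X * M + R
  value≡ = value-split i w
  R+2≤2M : R + 2 ≤ 2 * M
  R+2≤2M = subst (λ l → R + 2 ≤ 2 ^ suc l) (length-drop i w) (value+2≤2^suc-length (drop i w))

-- Prefix sequences

DigitStep : ℕ → ℕ → Set
DigitStep a b = 2 * a ≤ b × b ≤ 2 * a + 2

IsPrefixSequence : ℕ → (ℕ → ℕ) → Set
IsPrefixSequence K t = t 0 ≡ 0 × (∀ i → i < K → DigitStep (t i) (t (suc i)))

DigitStep-shift : ∀ a {b c} → DigitStep b c → DigitStep (a + b) (2 * a + c)
DigitStep-shift a {b} {c} (2b≤c , c≤2b+2) =
  subst (_≤ 2 * a + c) (sym (*-distribˡ-+ 2 a b)) (+-monoʳ-≤ (2 * a) 2b≤c) ,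
  subst (2 * a + c ≤_) (shift-identity a b) (+-monoʳ-≤ (2 * a) c≤2b+2)
  where
  shift-identity : ∀ a b → 2 * a + (2 * b + 2) ≡ 2 * (a + b) + 2
  shift-identity = solve-∀

sⱼ-digitStep : ∀ i w → i < length w → DigitStep (sⱼ i w) (sⱼ (suc i) w)
sⱼ-digitStep zero    (x ∷ w) _         rewrite sⱼ-1 x w = z≤n , digit≤2 x
sⱼ-digitStep (suc i) (x ∷ w) (s≤s i<)
  rewrite sⱼ-∷ i x w (<⇒≤ i<) | sⱼ-∷ (suc i) x w i< | x∙yz≈y∙xz *-commutativeSemigroup (toℕ x) 2 (2 ^ i) =
  DigitStep-shift (toℕ x * 2 ^ i) (sⱼ-digitStep i w i<)

sⱼ-isPrefixSequence : ∀ w → IsPrefixSequence (length w) (λ i → sⱼ i w)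
sⱼ-isPrefixSequence w = refl , λ i i< → sⱼ-digitStep i w i<

isPrefixSequence⇒word : ∀ K {t} → IsPrefixSequence K t →
  ∃[ w ] length w ≡ K × (∀ i → i ≤ K → sⱼ i w ≡ t i)
isPrefixSequence⇒word zero    (t0≡0 , _) = [] , refl , λ { zero z≤n → sym t0≡0 }
isPrefixSequence⇒word (suc K) {t} (t0≡0 , steps) = w ++ [ δ ] , length-w++δ , prefix
  where
  IH = isPrefixSequence⇒word K (t0≡0 , λ i i< → steps i (m<n⇒m<1+n i<))
  w = proj₁ IH
  |w|≡K = proj₁ (proj₂ IH)
  prefix-w = proj₂ (proj₂ IH)
  2tK≤t[1+K] = proj₁ (steps K ≤-refl)
  δ≤2 : t (suc K) ∸ 2 * t K ≤ 2
  δ≤2 = m≤n+o⇒m∸n≤o (t (suc K)) (2 * t K) (proj₂ (steps K ≤-refl))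
  δ : Fin 3
  δ = fromℕ< (s≤s δ≤2)
  length-w++δ : length (w ++ [ δ ]) ≡ suc K
  length-w++δ = trans (length-++ w) (trans (+-comm (length w) 1) (cong suc |w|≡K))
  value-w++δ : value (w ++ [ δ ]) ≡ t (suc K)
  value-w++δ = begin
    value (w ++ [ δ ])              ≡⟨ value-++ w [ δ ] ⟩
    value w * 2 + (toℕ δ * 1 + 0)   ≡⟨ cong₂ (λ a b → a * 2 + b) value-w (trans (sⱼ-1 δ []) (Fin.toℕ-fromℕ< (s≤s δ≤2))) ⟩
    t K * 2 + (t (suc K) ∸ 2 * t K) ≡⟨ cong (_+ (t (suc K) ∸ 2 * t K)) (*-comm (t K) 2) ⟩
    2 * t K + (t (suc K) ∸ 2 * t K) ≡⟨ m+[n∸m]≡n 2tK≤t[1+K] ⟩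
    t (suc K)                       ∎
    where
    open ≡-Reasoning
    value-w : value w ≡ t K
    value-w = trans (sym (sⱼ-≥length K w (≤-reflexive |w|≡K))) (prefix-w K ≤-refl)
  prefix : ∀ i → i ≤ suc K → sⱼ i (w ++ [ δ ]) ≡ t i
  prefix i i≤ with m≤n⇒m<n∨m≡n i≤
  ... | inj₁ i<  = trans (cong value (take-++-≤ i w [ δ ] (subst (i ≤_) (sym |w|≡K) (s≤s⁻¹ i<))))
                         (prefix-w i (s≤s⁻¹ i<))
  ... | inj₂ refl = trans (sⱼ-≥length (suc K) (w ++ [ δ ]) (≤-reflexive length-w++δ)) value-w++δ

sⱼ-injective : ∀ {c d : Word} → length c ≡ length d → (∀ i → i ≤ length c → sⱼ i c ≡ sⱼ i d) → c ≡ d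
sⱼ-injective {[]}    {[]}    _         _    = refl
sⱼ-injective {x ∷ c} {y ∷ d} |xc|≡|yd| same
  with Fin.toℕ-injective (trans (sym (sⱼ-1 x c)) (trans (same 1 (s≤s z≤n)) (sⱼ-1 y d)))
... | refl = cong (x ∷_) (sⱼ-injective |c|≡|d| λ i i≤ → +-cancelˡ-≡ (toℕ x * 2 ^ i) _ _ (begin
    toℕ x * 2 ^ i + sⱼ i c ≡⟨ sⱼ-∷ i x c i≤ ⟨
    sⱼ (suc i) (x ∷ c)     ≡⟨ same (suc i) (s≤s i≤) ⟩
    sⱼ (suc i) (x ∷ d)     ≡⟨ sⱼ-∷ i x d (subst (i ≤_) |c|≡|d| i≤) ⟩
    toℕ x * 2 ^ i + sⱼ i d ∎))
  where
  open ≡-Reasoning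
  |c|≡|d| = suc-injective |xc|≡|yd|

splice : ℕ → (ℕ → ℕ) → (ℕ → ℕ) → ℕ → ℕ
splice j f g i with i <? j
... | yes _ = f i
... | no  _ = g i

module _ {j : ℕ} {f g : ℕ → ℕ} where

  splice-< : ∀ {i} → i < j → splice j f g i ≡ f i
  splice-< {i} i<j with i <? j
  ... | yes _  = refl
  ... | no i≮j = contradiction i<j i≮j

  splice-≥ : ∀ {i} → j ≤ i → splice j f g i ≡ g i
  splice-≥ {i} j≤i with i <? j
  ... | yes i<j = contradiction i<j (≤⇒≯ j≤i)
  ... | no  _   = refl

  splice-pointwise : (P : ℕ → ℕ → Set) → (∀ i → P i (f i)) → (∀ i → P i (g i)) → ∀ i → P i (splice j f g i)
  splice-pointwise P Pf Pg i with i <? j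
  ... | yes _ = Pf i
  ... | no  _ = Pg i

splice-isPrefixSequence : ∀ {K f g} j → IsPrefixSequence K f → IsPrefixSequence K g →
  DigitStep (f j) (g (suc j)) → IsPrefixSequence K (splice (suc j) f g)
splice-isPrefixSequence {K} {f} {g} j (f0≡0 , f-steps) (_ , g-steps) junction = trans (t≡f z<s) f0≡0 , steps
  where
  t = splice (suc j) f g
  t≡f : ∀ {i} → i < suc j → t i ≡ f i
  t≡f = splice-< {suc j} {f} {g}
  t≡g : ∀ {i} → suc j ≤ i → t i ≡ g i
  t≡g = splice-≥ {suc j} {f} {g}
  steps : ∀ i → i < K → DigitStep (t i) (t (suc i))
  steps i i<K with <-cmp i j
  ... | tri< i<j _ _  = subst₂ DigitStep (sym (t≡f (m<n⇒m<1+n i<j))) (sym (t≡f (s≤s i<j))) (f-steps i i<K)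
  ... | tri≈ _ refl _ = subst₂ DigitStep (sym (t≡f ≤-refl)) (sym (t≡g ≤-refl)) junction
  ... | tri> _ _ j<i  = subst₂ DigitStep (sym (t≡g j<i)) (sym (t≡g (m≤n⇒m≤1+n j<i))) (g-steps i i<K)

-- Refinement and prefix values

SumsTo : List ℕ → ℕ → Set
SumsTo b p = sum b ≡ p

/-superadditive : ∀ m n o .{{_ : NonZero o}} → m / o + n / o ≤ (m + n) / o
/-superadditive m n o = begin
  m / o + n / o               ≡⟨ m*n/n≡m (m / o + n / o) o ⟨
  (m / o + n / o) * o / o     ≡⟨ cong (_/ o) (*-distribʳ-+ o (m / o) (n / o)) ⟩
  (m / o * o + n / o * o) / o ≤⟨ /-monoˡ-≤ o (+-mono-≤ (m/n*n≤m m o) (m/n*n≤m n o)) ⟩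
  (m + n) / o                 ∎
  where open ≤-Reasoning

module _ (T : ℕ) .{{_ : NonZero T}} where

  quotientSum : List ℕ → ℕ
  quotientSum xs = sum (map (_/ T) xs)

  quotientSum-++ : ∀ xs ys → quotientSum (xs ++ ys) ≡ quotientSum xs + quotientSum ys
  quotientSum-++ xs ys = trans (cong sum (map-++ (_/ T) xs ys)) (sum-++ (map (_/ T) xs) _)

  quotientSum-replicate : ∀ m x → quotientSum (replicate m x) ≡ m * (x / T)
  quotientSum-replicate zero    x = refl
  quotientSum-replicate (suc m) x = cong (x / T +_) (quotientSum-replicate m x)

  quotientSum≤sum/ : ∀ xs → quotientSum xs ≤ sum xs / T
  quotientSum≤sum/ []       = ≤-reflexive (sym (0/n≡0 T))
  quotientSum≤sum/ (x ∷ xs) = ≤-trans (+-monoʳ-≤ (x / T) (quotientSum≤sum/ xs)) (/-superadditive x (sum xs) T)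

  quotientSum-concat : ∀ {bs λ′} → Pointwise SumsTo bs λ′ → quotientSum (concat bs) ≤ quotientSum λ′
  quotientSum-concat [] = ≤-refl
  quotientSum-concat {b ∷ bs} {p ∷ λ′} (Σb≡p ∷ rest) = begin
    quotientSum (b ++ concat bs)            ≡⟨ quotientSum-++ b (concat bs) ⟩
    quotientSum b + quotientSum (concat bs) ≤⟨ +-mono-≤ (≤-trans (quotientSum≤sum/ b) (≤-reflexive (cong (_/ T) Σb≡p)))
                                                        (quotientSum-concat rest) ⟩
    p / T + quotientSum λ′                  ∎
    where open ≤-Reasoning

  quotientSum-refines : ∀ {μ λ′} → Refines μ λ′ → quotientSum μ ≤ quotientSum λ′
  quotientSum-refines {λ′ = λ′} (bs , sums , concat↭μ) =
    subst (_≤ quotientSum λ′) (sum-↭ (↭.map⁺ (_/ T) concat↭μ)) (quotientSum-concat sums)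

module _ (m : ℕ) where
  private instance
    2^m-nonZero : NonZero (2 ^ m)
    2^m-nonZero = m^n≢0 2 m

  2^[i+m]/2^m≡2^i : ∀ i → 2 ^ (i + m) / 2 ^ m ≡ 2 ^ i
  2^[i+m]/2^m≡2^i i = trans (cong (_/ 2 ^ m) (^-distribˡ-+-* 2 i m)) (m*n/n≡m (2 ^ i) (2 ^ m))

  quotientSum-parts-∷ : ∀ x w →
    quotientSum (2 ^ m) (parts (x ∷ w)) ≡ toℕ x * (2 ^ length w / 2 ^ m) + quotientSum (2 ^ m) (parts w)
  quotientSum-parts-∷ x w =
    trans (quotientSum-++ (2 ^ m) (replicate (toℕ x) (2 ^ length w)) (parts w))
          (cong (_+ quotientSum (2 ^ m) (parts w)) (quotientSum-replicate (2 ^ m) (toℕ x) (2 ^ length w)))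

  quotientSum-parts-short : ∀ w → length w ≤ m → quotientSum (2 ^ m) (parts w) ≡ 0
  quotientSum-parts-short []      _     = refl
  quotientSum-parts-short (x ∷ w) |w|<m = begin
    quotientSum (2 ^ m) (parts (x ∷ w))                             ≡⟨ quotientSum-parts-∷ x w ⟩
    toℕ x * (2 ^ length w / 2 ^ m) + quotientSum (2 ^ m) (parts w)
      ≡⟨ cong₂ (λ q r → toℕ x * q + r) (m<n⇒m/n≡0 (^-monoʳ-< 2 (s≤s (s≤s z≤n)) |w|<m))
                                        (quotientSum-parts-short w (<⇒≤ |w|<m)) ⟩
    toℕ x * 0 + 0                                                   ≡⟨ cong (_+ 0) (*-zeroʳ (toℕ x)) ⟩
    0                                                               ∎
    where open ≡-Reasoning

  quotientSum-parts : ∀ i w → i + m ≡ length w → quotientSum (2 ^ m) (parts w) ≡ sⱼ i w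
  quotientSum-parts zero    w       m≡|w| = quotientSum-parts-short w (≤-reflexive (sym m≡|w|))
  quotientSum-parts (suc i) (x ∷ w) i+m≡ = begin
    quotientSum (2 ^ m) (parts (x ∷ w))                             ≡⟨ quotientSum-parts-∷ x w ⟩
    toℕ x * (2 ^ length w / 2 ^ m) + quotientSum (2 ^ m) (parts w)
      ≡⟨ cong₂ (λ q r → toℕ x * q + r) 2^|w|/2^m≡2^i (quotientSum-parts i w (suc-injective i+m≡)) ⟩
    toℕ x * 2 ^ i + sⱼ i w                                          ≡⟨ sⱼ-∷ i x w i≤|w| ⟨
    sⱼ (suc i) (x ∷ w)                                              ∎
    where
    open ≡-Reasoning
    i≤|w| : i ≤ length w
    i≤|w| = subst (i ≤_) (suc-injective i+m≡) (m≤m+n i m)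
    2^|w|/2^m≡2^i : 2 ^ length w / 2 ^ m ≡ 2 ^ i
    2^|w|/2^m≡2^i = trans (cong (λ l → 2 ^ l / 2 ^ m) (sym (suc-injective i+m≡))) (2^[i+m]/2^m≡2^i i)

≤D⇒sⱼ-≤ : ∀ {c d} → length c ≡ length d → c ≤D d → ∀ i → i ≤ length c → sⱼ i c ≤ sⱼ i d
≤D⇒sⱼ-≤ {c} {d} |c|≡|d| c≤d i i≤ = begin
  sⱼ i c                         ≡⟨ quotientSum-parts m i c i+m≡|c| ⟨
  quotientSum (2 ^ m) (parts c)  ≤⟨ quotientSum-refines (2 ^ m) c≤d ⟩
  quotientSum (2 ^ m) (parts d)  ≡⟨ quotientSum-parts m i d (trans i+m≡|c| |c|≡|d|) ⟩
  sⱼ i d                         ∎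
  where
  open ≤-Reasoning
  m = length c ∸ i
  instance
    2^m-nonZero : NonZero (2 ^ m)
    2^m-nonZero = m^n≢0 2 m
  i+m≡|c| : i + m ≡ length c
  i+m≡|c| = m+[n∸m]≡n i≤

Refines-++⁺ˡ : ∀ xs {μ λ′} → Refines μ λ′ → Refines (xs ++ μ) (xs ++ λ′)
Refines-++⁺ˡ xs {μ} (bs , sums , concat↭μ) =
  map [_] xs ++ bs , Pointwise.++⁺ (singletons xs) sums ,
  subst (_↭ xs ++ μ) (trans (cong (_++ concat bs) (sym (concat-map-[_] xs))) (concat-++ (map [_] xs) bs))
        (↭.++⁺ˡ xs concat↭μ)
  where
  singletons : ∀ xs → Pointwise SumsTo (map [_] xs) xs
  singletons []       = []
  singletons (x ∷ xs) = +-identityʳ x ∷ singletons xs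

module _ (h : ℕ) {ρ : List ℕ} where

  pairUp-blocks : ∀ e {bs} → Pointwise SumsTo bs (replicate (2 * e) h ++ ρ) →
                  ∃[ bs′ ] Pointwise SumsTo bs′ (replicate e (2 * h) ++ ρ) × concat bs′ ≡ concat bs
  pairUp-blocks zero    sums      = _ , sums , refl
  pairUp-blocks (suc e) {bs} sums = pairUp-∷ (subst (λ m → Pointwise SumsTo bs (replicate m h ++ ρ)) (*-suc 2 e) sums)
    where
    pairUp-∷ : ∀ {bs} → Pointwise SumsTo bs (h ∷ h ∷ replicate (2 * e) h ++ ρ) →
               ∃[ bs′ ] Pointwise SumsTo bs′ (replicate (suc e) (2 * h) ++ ρ) × concat bs′ ≡ concat bs
    pairUp-∷ {a ∷ b ∷ _} (Σa≡h ∷ Σb≡h ∷ sums) with pairUp-blocks e sums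
    ... | bs′ , sums′ , concat≡ =
      (a ++ b) ∷ bs′ ,
      trans (sum-++ a b) (trans (cong₂ _+_ Σa≡h Σb≡h) (cong (h +_) (sym (+-identityʳ h)))) ∷ sums′ ,
      trans (++-assoc a b (concat bs′)) (cong (λ z → a ++ b ++ z) concat≡)

  Refines-pairUp : ∀ e {μ} → Refines μ (replicate (2 * e) h ++ ρ) → Refines μ (replicate e (2 * h) ++ ρ)
  Refines-pairUp e {μ} (bs , sums , concat↭μ) =
    let bs′ , sums′ , concat≡ = pairUp-blocks e sums in bs′ , sums′ , subst (_↭ μ) (sym concat≡) concat↭μ

replicate-+-++ : ∀ {A : Set} m n (x : A) ρ → replicate (m + n) x ++ ρ ≡ replicate m x ++ replicate n x ++ ρ
replicate-+-++ zero    n x ρ = refl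
replicate-+-++ (suc m) n x ρ = cong (x ∷_) (replicate-+-++ m n x ρ)

-- Under these bounds the parts of c refine those of d together with e extra parts of size
-- 2 ^ length c; after the leading digits x and y, 2 e + y ∸ x extra parts of half that size remain.
CarryBound : ℕ → Word → Word → Set
CarryBound e c d = value c ≡ e * 2 ^ length c + value d × (∀ i → i ≤ length c → sⱼ i c ≤ e * 2 ^ i + sⱼ i d)

CarryBound-∷ : ∀ {e x y c d} → length c ≡ length d → CarryBound e (x ∷ c) (y ∷ d) →
  ∃[ e′ ] toℕ x + e′ ≡ 2 * e + toℕ y × CarryBound e′ c d
CarryBound-∷ {e} {x} {y} {c} {d} |c|≡|d| (value≡ , bounds) = e′ , X+e′≡2e+Y , value≡′ , bounds′
  where
  X = toℕ x
  Y = toℕ y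
  X≤2e+Y : X ≤ 2 * e + Y
  X≤2e+Y = subst₂ _≤_ (sⱼ-1 x c) (cong₂ _+_ (*-comm e 2) (sⱼ-1 y d)) (bounds 1 (s≤s z≤n))
  e′ = 2 * e + Y ∸ X
  X+e′≡2e+Y : X + e′ ≡ 2 * e + Y
  X+e′≡2e+Y = m+[n∸m]≡n X≤2e+Y
  carry : ∀ P D → e * (2 * P) + (Y * P + D) ≡ X * P + (e′ * P + D)
  carry P D = begin
    e * (2 * P) + (Y * P + D) ≡⟨ collect e Y P D ⟩
    (2 * e + Y) * P + D       ≡⟨ cong (λ a → a * P + D) X+e′≡2e+Y ⟨
    (X + e′) * P + D          ≡⟨ distribute X e′ P D ⟩
    X * P + (e′ * P + D)      ∎
    where
    open ≡-Reasoning
    collect : ∀ e Y P D → e * (2 * P) + (Y * P + D) ≡ (2 * e + Y) * P + D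
    collect = solve-∀
    distribute : ∀ X e′ P D → (X + e′) * P + D ≡ X * P + (e′ * P + D)
    distribute = solve-∀
  value≡′ : value c ≡ e′ * 2 ^ length c + value d
  value≡′ = +-cancelˡ-≡ (X * 2 ^ length c) _ _ (trans value≡ (trans
    (cong (λ l → e * (2 * 2 ^ length c) + (Y * 2 ^ l + value d)) (sym |c|≡|d|))
    (carry (2 ^ length c) (value d))))
  bounds′ : ∀ i → i ≤ length c → sⱼ i c ≤ e′ * 2 ^ i + sⱼ i d
  bounds′ i i≤ = +-cancelˡ-≤ (X * 2 ^ i) _ _
    (subst₂ _≤_ (sⱼ-∷ i x c i≤)
                (trans (cong (e * 2 ^ suc i +_) (sⱼ-∷ i y d (subst (i ≤_) |c|≡|d| i≤))) (carry (2 ^ i) (sⱼ i d)))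
                (bounds (suc i) (s≤s i≤)))

CarryBound⇒Refines : ∀ e c d → length c ≡ length d → CarryBound e c d →
  Refines (parts c) (replicate e (2 ^ length c) ++ parts d)
CarryBound⇒Refines zero    []      []      _ _        = [] , [] , ↭-refl
CarryBound⇒Refines (suc e) []      []      _ (() , _)
CarryBound⇒Refines e       (x ∷ c) (y ∷ d) |xc|≡|yd| bound
  with CarryBound-∷ {e} (suc-injective |xc|≡|yd|) bound
... | e′ , X+e′≡2e+Y , bound′ =
  subst (Refines (parts (x ∷ c))) coarse≡ (Refines-pairUp h e (subst (Refines (parts (x ∷ c))) fine≡ fine))
  where
  h = 2 ^ length c
  fine : Refines (parts (x ∷ c)) (replicate (toℕ x) h ++ replicate e′ h ++ parts d)
  fine = Refines-++⁺ˡ (replicate (toℕ x) h) (CarryBound⇒Refines e′ c d (suc-injective |xc|≡|yd|) bound′)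
  fine≡ : replicate (toℕ x) h ++ replicate e′ h ++ parts d ≡ replicate (2 * e) h ++ replicate (toℕ y) h ++ parts d
  fine≡ = trans (sym (replicate-+-++ (toℕ x) e′ h (parts d)))
                (trans (cong (λ a → replicate a h ++ parts d) X+e′≡2e+Y) (replicate-+-++ (2 * e) (toℕ y) h (parts d)))
  coarse≡ : replicate e (2 * h) ++ replicate (toℕ y) h ++ parts d ≡ replicate e (2 ^ length (x ∷ c)) ++ parts (y ∷ d)
  coarse≡ = cong (λ l → replicate e (2 * h) ++ replicate (toℕ y) (2 ^ l) ++ parts d) (suc-injective |xc|≡|yd|)

sⱼ-≤⇒≤D : ∀ {c d} → length c ≡ length d → value c ≡ value d →
  (∀ i → i ≤ length c → sⱼ i c ≤ sⱼ i d) → c ≤D d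
sⱼ-≤⇒≤D {c} {d} |c|≡|d| value≡ bounds = CarryBound⇒Refines 0 c d |c|≡|d| (value≡ , bounds)

-- Covers in ℕʳ

tabulate-⋖ : ∀ {r} {f g : Fin r → ℕ} → (∀ p → f p ≤ g p) → (∀ p → g p ≤ suc (f p)) →
  (∀ p q → f p < g p → f q < g q → p ≡ q) → ¬ (∀ p → f p ≡ g p) → CoversNʳ r (tabulate f) (tabulate g)
tabulate-⋖ {r} {f} {g} f≤g g≤1+f strict-once f≠g = Pointwiseᵥ.tabulate⁺ f≤g , tf≢tg , between
  where
  tf≢tg : tabulate f ≢ tabulate g
  tf≢tg tf≡tg = f≠g (Pointwiseᵥ.tabulate⁻ (Pointwiseᵥ.≡⇒Pointwise-≡ tf≡tg))
  between : (z : Vec ℕ r) → ⊤ → tabulate f ≤ᵥ z → z ≤ᵥ tabulate g → z ≡ tabulate f ⊎ z ≡ tabulate g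
  between z _ f≤z z≤g with ≡-dec _≟_ z (tabulate f) | ≡-dec _≟_ z (tabulate g)
  ... | yes z≡f | _       = inj₁ z≡f
  ... | no _    | yes z≡g = inj₂ z≡g
  ... | no z≢f  | no z≢g  = ⊥-elim (zq≢gq (subst (λ x → lookup z x ≡ g x) p≡q zp≡gp))
    where
    f≤zᵢ : ∀ p → f p ≤ lookup z p
    f≤zᵢ p = subst (_≤ lookup z p) (lookup∘tabulate f p) (Pointwiseᵥ.lookup f≤z p)
    zᵢ≤g : ∀ p → lookup z p ≤ g p
    zᵢ≤g p = subst (lookup z p ≤_) (lookup∘tabulate g p) (Pointwiseᵥ.lookup z≤g p)
    differs : ∀ {h} → z ≢ tabulate h → ∃[ p ] lookup z p ≢ h p
    differs {h} z≢h = Fin.¬∀⟶∃¬ r _ (λ p → lookup z p ≟ h p)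
      λ same → z≢h (trans (sym (tabulate∘lookup z)) (tabulate-cong same))
    p = proj₁ (differs z≢f)
    q = proj₁ (differs z≢g)
    zq≢gq = proj₂ (differs z≢g)
    fp<zp : f p < lookup z p
    fp<zp = ≤∧≢⇒< (f≤zᵢ p) (λ fp≡zp → proj₂ (differs z≢f) (sym fp≡zp))
    zp≡gp : lookup z p ≡ g p
    zp≡gp = ≤-antisym (zᵢ≤g p) (≤-trans (g≤1+f p) fp<zp)
    p≡q : p ≡ q
    p≡q = strict-once p q (<-≤-trans fp<zp (zᵢ≤g p)) (≤-<-trans (f≤zᵢ q) (≤∧≢⇒< (zᵢ≤g q) zq≢gq))

-- The binary expansion

-- bitsLSB lists bits least significant first, so this counts the trailing 1s of β n.
leadingTrues : List Bool → ℕ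
leadingTrues (true ∷ bs) = suc (leadingTrues bs)
leadingTrues _           = 0

2^leadingTrues∣suc : ∀ f m i → i ≤ leadingTrues (bitsLSB f m) → 2 ^ i ∣ suc m
2^leadingTrues∣suc f       m zero    _  = 1∣ suc m
2^leadingTrues∣suc zero    m (suc i) ()
2^leadingTrues∣suc (suc f) m (suc i) i< with m ≡ᵇ 0
... | true  = contradiction i< λ ()
... | false with m % 2 ≡ᵇ 1 in m%2≡ᵇ1
...   | false = contradiction i< λ ()
...   | true  =
  subst (2 ^ suc i ∣_) (sym suc-m≡2*suc[m/2]) (*-monoʳ-∣ 2 (2^leadingTrues∣suc f (m / 2) i (s≤s⁻¹ i<)))
  where
  suc-m≡2*suc[m/2] : suc m ≡ 2 * suc (m / 2)
  suc-m≡2*suc[m/2] = begin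
    suc m                     ≡⟨ cong suc (m≡m%n+[m/n]*n m 2) ⟩
    suc (m % 2 + m / 2 * 2)   ≡⟨ cong (λ r → suc (r + m / 2 * 2)) (≡ᵇ⇒≡ (m % 2) 1 (subst T (sym m%2≡ᵇ1) tt)) ⟩
    suc (suc (m / 2 * 2))     ≡⟨ odd (m / 2) ⟩
    2 * suc (m / 2)           ∎
    where
    open ≡-Reasoning
    odd : ∀ q → suc (suc (q * 2)) ≡ 2 * suc q
    odd = solve-∀

rightmostZero-∷ʳ-true : ∀ bs → rightmostZero (bs ++ [ true ]) ≡ rightmostZero bs
rightmostZero-∷ʳ-true []       = refl
rightmostZero-∷ʳ-true (b ∷ bs) rewrite rightmostZero-∷ʳ-true bs = refl

rightmostZero-∷ʳ-false : ∀ bs → rightmostZero (bs ++ [ false ]) ≡ just (length bs)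
rightmostZero-∷ʳ-false []       = refl
rightmostZero-∷ʳ-false (b ∷ bs) rewrite rightmostZero-∷ʳ-false bs = refl

length≤rightmostZero+leadingTrues : ∀ bs →
  length bs ≤ suc (maybe id 0 (rightmostZero (reverse bs)) + leadingTrues bs)
length≤rightmostZero+leadingTrues [] = z≤n
length≤rightmostZero+leadingTrues (true ∷ bs)
  rewrite unfold-reverse true bs | rightmostZero-∷ʳ-true (reverse bs)
        | +-suc (maybe id 0 (rightmostZero (reverse bs))) (leadingTrues bs) =
  s≤s (length≤rightmostZero+leadingTrues bs)
length≤rightmostZero+leadingTrues (false ∷ bs)
  rewrite unfold-reverse false bs | rightmostZero-∷ʳ-false (reverse bs) | length-reverse bs = s≤s (m≤m+n (length bs) 0)

2^[len∸j]∣suc : ∀ n j → ppLen n < j → 2 ^ (len n ∸ j) ∣ suc n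
2^[len∸j]∣suc n j r<j = 2^leadingTrues∣suc n n (len n ∸ j) (begin
  len n ∸ j                         ≤⟨ ∸-monoʳ-≤ (len n) r<j ⟩
  len n ∸ suc (ppLen n)             ≤⟨ m≤n+o⇒m∸n≤o (len n) (suc (ppLen n)) len≤ ⟩
  leadingTrues (bitsLSB n n)        ∎)
  where
  open ≤-Reasoning
  len≤ : len n ≤ suc (ppLen n) + leadingTrues (bitsLSB n n)
  len≤ = subst (_≤ suc (ppLen n) + leadingTrues (bitsLSB n n)) (sym (length-reverse (bitsLSB n n)))
               (length≤rightmostZero+leadingTrues (bitsLSB n n))

-- Two expansions of n

∣suc⇒quotient : ∀ {M n X} → M ∣ suc n → X * M ≤ n → n + 2 ≤ (X + 2) * M → suc X * M ≡ suc n
∣suc⇒quotient {M} {n} {X} (divides q suc-n≡qM) XM≤n n+2≤ = trans (cong (_* M) (sym q≡1+X)) (sym suc-n≡qM)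
  where
  open ≤-Reasoning
  X<q : X < q
  X<q = *-cancelʳ-< M X q (begin-strict
    X * M ≤⟨ XM≤n ⟩
    n     <⟨ n<1+n n ⟩
    suc n ≡⟨ suc-n≡qM ⟩
    q * M ∎)
  q<2+X : q < 2 + X
  q<2+X = subst (q <_) (+-comm X 2) (*-cancelʳ-< M q (X + 2) (begin-strict
    q * M       ≡⟨ suc-n≡qM ⟨
    suc n       ≡⟨ +-comm 1 n ⟩
    n + 1       <⟨ +-monoʳ-< n ≤-refl ⟩
    n + 2       ≤⟨ n+2≤ ⟩
    (X + 2) * M ∎))
  q≡1+X : q ≡ suc X
  q≡1+X = ≤-antisym (s≤s⁻¹ q<2+X) X<q

IsHB⇒sⱼ≡n : ∀ {n w} → IsHB n w → ∀ i → len n ≤ i → sⱼ i w ≡ n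
IsHB⇒sⱼ≡n {w = w} (|w|≡ , value≡) i len≤i = trans (sⱼ-≥length i w (subst (_≤ i) (sym |w|≡) len≤i)) value≡

IsHB⇒isPrefixSequence : ∀ {n w} → IsHB n w → IsPrefixSequence (len n) (λ i → sⱼ i w)
IsHB⇒isPrefixSequence {w = w} (|w|≡ , _) =
  subst (λ K → IsPrefixSequence K (λ i → sⱼ i w)) |w|≡ (sⱼ-isPrefixSequence w)

module TwoExpansions {n} (c d : Word) (hc : IsHB n c) (hd : IsHB n d) where

  private
    |c|≡|d| : length c ≡ length d
    |c|≡|d| = trans (proj₁ hc) (sym (proj₁ hd))

    brackets : ∀ {w} → IsHB n w → ∀ i → sⱼ i w * 2 ^ (len n ∸ i) ≤ n × n + 2 ≤ (sⱼ i w + 2) * 2 ^ (len n ∸ i)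
    brackets {w} (|w|≡ , value≡) i = sⱼ-brackets i w |w|≡ value≡

  sⱼ-≤-suc : ∀ i → sⱼ i d ≤ suc (sⱼ i c)
  sⱼ-≤-suc i = s≤s⁻¹ (subst (sⱼ i d <_) (+-comm (sⱼ i c) 2) (*-cancelʳ-< M (sⱼ i d) (sⱼ i c + 2) (begin-strict
    sⱼ i d * M       ≤⟨ proj₁ (brackets hd i) ⟩
    n                <⟨ m<m+n n (s≤s z≤n) ⟩
    n + 2            ≤⟨ proj₂ (brackets hc i) ⟩
    (sⱼ i c + 2) * M ∎)))
    where
    open ≤-Reasoning
    M = 2 ^ (len n ∸ i)

  sⱼ-≡-beyond-ppLen : ∀ j → ppLen n < j → sⱼ j c ≡ sⱼ j d
  sⱼ-≡-beyond-ppLen j r<j =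
    suc-injective (*-cancelʳ-≡ (suc (sⱼ j c)) (suc (sⱼ j d)) M (trans (exact hc) (sym (exact hd))))
    where
    M = 2 ^ (len n ∸ j)
    instance
      M-nonZero : NonZero M
      M-nonZero = m^n≢0 2 (len n ∸ j)
    exact : ∀ {w} → IsHB n w → suc (sⱼ j w) * M ≡ suc n
    exact {w} hw = ∣suc⇒quotient {X = sⱼ j w} (2^[len∸j]∣suc n j r<j) (proj₁ (brackets hw j)) (proj₂ (brackets hw j))

  ≡-of-sⱼ-on-principal-prefix : (∀ (p : Fin (ppLen n)) → sⱼ (suc (toℕ p)) c ≡ sⱼ (suc (toℕ p)) d) → c ≡ d
  ≡-of-sⱼ-on-principal-prefix same = sⱼ-injective |c|≡|d| (λ i _ → agree i)
    where
    agree : ∀ i → sⱼ i c ≡ sⱼ i d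
    agree zero = refl
    agree (suc i) with suc i ≤? ppLen n
    ... | yes i<r = subst (λ m → sⱼ (suc m) c ≡ sⱼ (suc m) d) (Fin.toℕ-fromℕ< i<r) (same (fromℕ< i<r))
    ... | no  i≮r = sⱼ-≡-beyond-ppLen (suc i) (≰⇒> i≮r)

  module _ (c⋖d : CoversD n c d) where

    private
      k = len n
      u v : ℕ → ℕ
      u i = sⱼ i c
      v i = sⱼ i d
      u≡v-from-k : ∀ {i} → k ≤ i → u i ≡ v i
      u≡v-from-k {i} k≤i = trans (IsHB⇒sⱼ≡n hc i k≤i) (sym (IsHB⇒sⱼ≡n hd i k≤i))

    sⱼ-≤ : ∀ i → sⱼ i c ≤ sⱼ i d
    sⱼ-≤ i with i ≤? k
    ... | yes i≤k = ≤D⇒sⱼ-≤ |c|≡|d| (proj₁ c⋖d) i (subst (i ≤_) (sym (proj₁ hc)) i≤k)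
    ... | no  i≰k = ≤-reflexive (u≡v-from-k (<⇒≤ (≰⇒> i≰k)))

    private
      Between : (ℕ → ℕ) → Set
      Between t = ∀ i → u i ≤ t i × t i ≤ v i

      u-between : Between u
      u-between i = ≤-refl , sⱼ-≤ i

      v-between : Between v
      v-between i = sⱼ-≤ i , ≤-refl

      splice-between : ∀ q {f g} → Between f → Between g → Between (splice q f g)
      splice-between q {f} {g} = splice-pointwise {q} {f} {g} (λ i x → u i ≤ x × x ≤ v i)

      c-seq : IsPrefixSequence k u
      c-seq = IsHB⇒isPrefixSequence hc

      d-seq : IsPrefixSequence k v
      d-seq = IsHB⇒isPrefixSequence hd

      strict⇒<len : ∀ {i} → u i < v i → i < k
      strict⇒<len ui<vi = ≰⇒> λ k≤i → <⇒≢ ui<vi (u≡v-from-k k≤i)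

      no-sequence-strictly-between : ∀ t → IsPrefixSequence k t → t k ≡ n → Between t →
        ∀ {a b} → a ≤ k → b ≤ k → t a ≢ u a → t b ≢ v b → ⊥
      no-sequence-strictly-between t t-seq tk≡n t-between {a} {b} a≤k b≤k ta≢ua tb≢vb
        with isPrefixSequence⇒word k t-seq
      ... | w , |w|≡k , sⱼ-w≡t =
        [ (λ w≡c → ta≢ua (trans (sym (sⱼ-w≡t a a≤k)) (cong (sⱼ a) w≡c)))
        , (λ w≡d → tb≢vb (trans (sym (sⱼ-w≡t b b≤k)) (cong (sⱼ b) w≡d))) ]′
        (proj₂ (proj₂ c⋖d) w (|w|≡k , value-w) c≤w w≤d)
        where
        value-w : value w ≡ n
        value-w = trans (sym (sⱼ-≥length k w (≤-reflexive |w|≡k))) (trans (sⱼ-w≡t k ≤-refl) tk≡n)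
        c≤w : c ≤D w
        c≤w = sⱼ-≤⇒≤D (trans (proj₁ hc) (sym |w|≡k)) (trans (proj₂ hc) (sym value-w)) λ i i≤ →
          subst (u i ≤_) (sym (sⱼ-w≡t i (subst (i ≤_) (proj₁ hc) i≤))) (proj₁ (t-between i))
        w≤d : w ≤D d
        w≤d = sⱼ-≤⇒≤D (trans |w|≡k (sym (proj₁ hd))) (trans value-w (sym (proj₂ hd))) λ i i≤ →
          subst (_≤ v i) (sym (sⱼ-w≡t i (subst (i ≤_) |w|≡k i≤))) (proj₂ (t-between i))

      -- Splicing the two prefix sequences at q (v before q and u from q on, or the reverse) gives a
      -- sequence strictly between them; the junction at q decides which of the two splices is valid.
      no-two-strict : ∀ {p q} → p < q → u p < v p → u q < v q → ⊥
      no-two-strict {p} {suc j} p<q up<vp uq<vq = by-cases (2 * v j ≤? u q)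
        where
        q = suc j
        q<k = strict⇒<len uq<vq
        j<k = <-trans (n<1+n j) q<k
        p≤k = <⇒≤ (<-trans p<q q<k)
        splice-end : ∀ {f g} → g k ≡ n → splice q f g k ≡ n
        splice-end {f} {g} = trans (splice-≥ {q} {f} {g} (<⇒≤ q<k))
        by-cases : Dec (2 * v j ≤ u q) → ⊥
        by-cases (yes 2vj≤uq) = no-sequence-strictly-between (splice q v u)
          (splice-isPrefixSequence j d-seq c-seq (2vj≤uq , ≤-trans (<⇒≤ uq<vq) (proj₂ (proj₂ d-seq j j<k))))
          (splice-end (IsHB⇒sⱼ≡n hc k ≤-refl)) (splice-between q v-between u-between) p≤k (<⇒≤ q<k)
          (λ tp≡up → <⇒≢ up<vp (trans (sym tp≡up) (splice-< {q} {v} {u} p<q)))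
          (λ tq≡vq → <⇒≢ uq<vq (trans (sym (splice-≥ {q} {v} {u} ≤-refl)) tq≡vq))
        by-cases (no 2vj≰uq) = no-sequence-strictly-between (splice q u v)
          (splice-isPrefixSequence j c-seq d-seq (≤-trans (proj₁ (proj₂ c-seq j j<k)) (<⇒≤ uq<vq) , vq≤2uj+2))
          (splice-end (IsHB⇒sⱼ≡n hd k ≤-refl)) (splice-between q u-between v-between) (<⇒≤ q<k) p≤k
          (λ tq≡uq → <⇒≢ uq<vq (sym (trans (sym (splice-≥ {q} {u} {v} ≤-refl)) tq≡uq)))
          (λ tp≡vp → <⇒≢ up<vp (trans (sym (splice-< {q} {u} {v} p<q)) tp≡vp))
          where
          vq≤2uj+2 : v q ≤ 2 * u j + 2
          vq≤2uj+2 = begin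
            v q           ≤⟨ sⱼ-≤-suc q ⟩
            suc (u q)     ≤⟨ ≰⇒> 2vj≰uq ⟩
            2 * v j       ≤⟨ *-monoʳ-≤ 2 (sⱼ-≤-suc j) ⟩
            2 * suc (u j) ≡⟨ trans (*-suc 2 (u j)) (+-comm 2 (2 * u j)) ⟩
            2 * u j + 2   ∎
            where open ≤-Reasoning

    strict-at-most-once : ∀ p q → sⱼ p c < sⱼ p d → sⱼ q c < sⱼ q d → p ≡ q
    strict-at-most-once p q up<vp uq<vq with <-cmp p q
    ... | tri< p<q _ _ = ⊥-elim (no-two-strict p<q up<vp uq<vq)
    ... | tri≈ _ p≡q _ = p≡q
    ... | tri> _ _ q<p = ⊥-elim (no-two-strict q<p uq<vq up<vp)

proposition3p8 : (n : ℕ) → 1 ≤ n → (c d : Word) → IsHB n c → IsHB n d →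
    CoversD n c d → CoversNʳ (ppLen n) (𝗌 (ppLen n) c) (𝗌 (ppLen n) d)
proposition3p8 n _ c d hc hd c⋖d@(_ , c≢d , _) =
  tabulate-⋖ (λ p → sⱼ-≤ c⋖d (suc (toℕ p)))
             (λ p → sⱼ-≤-suc (suc (toℕ p)))
             (λ p q up<vp uq<vq → Fin.toℕ-injective (suc-injective (strict-at-most-once c⋖d _ _ up<vp uq<vq)))
             (c≢d ∘ ≡-of-sⱼ-on-principal-prefix)
  where open TwoExpansions c d hc hd
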